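{- Let $n$ be a positive integer and let $\mathcal{B}$ be a balanced bipartite graph on $2n$ vertices with parts $V_1$ and $V_2$ (each of size $n$), and suppose $\delta(\mathcal{B})\geq \frac{n}{2}+1$. Let $S\subseteq V(\mathcal{B})$ with $|S|=n+1$ such that the induced subgraph $\mathcal{B}[S]$ is a forest. If $\min\{|S\cap V_1|,|S\cap V_2|\}=2$, then $n$ is even.
   Context: All graphs are finite and simple. A balanced bipartite graph on $2n$ vertices is a bipartite graph with bipartition $V_1,V_2$, $|V_1|=|V_2|=n$. $\delta(G)$ is the minimum degree and $G[S]$ is the subgraph induced by $S$. -}

module Defs where

open import Data.Nat using (ℕ; zero; suc; _+_; _*_; _≤_)
open import Data.Bool using (Bool; true; false)
open import Data.Fin using (Fin; zero; suc; inject₁; fromℕ)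
open import Data.Fin.Subset using (Subset; _∈_; ∣_∣)
open import Data.Vec using (tabulate)
open import Data.Sum using (_⊎_; inj₁; inj₂)
open import Data.Empty using (⊥)
open import Function.Definitions using (Injective)
open import Relation.Binary.PropositionalEquality using (_≡_)

-- A balanced bipartite (simple) graph on 2n vertices with parts V₁ = V₂ = Fin n.
-- Vertex set: Fin n ⊎ Fin n  (inj₁ = V₁, inj₂ = V₂).
-- Edges only go between V₁ and V₂; edge i j = true means i ∈ V₁ is adjacent to j ∈ V₂.
record BBGraph (n : ℕ) : Set where
  field
    edge : Fin n → Fin n → Bool

open BBGraph public

Vertex : ℕ → Set
Vertex n = Fin n ⊎ Fin n

Adj : ∀ {n} → BBGraph n → Vertex n → Vertex n → Set
Adj B (inj₁ i) (inj₂ j) = edge B i j ≡ true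
Adj B (inj₂ j) (inj₁ i) = edge B i j ≡ true
Adj B (inj₁ _) (inj₁ _) = ⊥
Adj B (inj₂ _) (inj₂ _) = ⊥

deg : ∀ {n} → BBGraph n → Vertex n → ℕ
deg B (inj₁ i) = ∣ tabulate (λ j → edge B i j) ∣
deg B (inj₂ j) = ∣ tabulate (λ i → edge B i j) ∣

-- δ(B) ≥ n/2 + 1, stated without division: every vertex v has 2·deg v ≥ n + 2.
MinDegreeAtLeastHalfPlusOne : ∀ {n} → BBGraph n → Set
MinDegreeAtLeastHalfPlusOne {n} B = ∀ v → n + 2 ≤ 2 * deg B v

record VSubset (n : ℕ) : Set where
  constructor ⟨_,_⟩
  field
    part₁ : Subset n
    part₂ : Subset n

open VSubset public

_∈S_ : ∀ {n} → Vertex n → VSubset n → Set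
inj₁ i ∈S S = i ∈ part₁ S
inj₂ j ∈S S = j ∈ part₂ S

size : ∀ {n} → VSubset n → ℕ
size S = ∣ part₁ S ∣ + ∣ part₂ S ∣

-- A cycle in the induced subgraph B[S]: k = m + 3 ≥ 3 pairwise distinct vertices
-- v₀,…,v_{k-1}, all in S, with vᵢ ~ vᵢ₊₁ and v_{k-1} ~ v₀.
record CycleIn {n} (B : BBGraph n) (S : VSubset n) : Set where
  field
    m      : ℕ
    vs     : Fin (3 + m) → Vertex n
    inj    : Injective _≡_ _≡_ vs
    inS    : ∀ i → vs i ∈S S
    step   : ∀ (i : Fin (2 + m)) → Adj B (vs (inject₁ i)) (vs (suc i))
    close  : Adj B (vs (fromℕ (2 + m))) (vs zero)

IsForest : ∀ {n} → BBGraph n → VSubset n → Set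
IsForest B S = CycleIn B S → ⊥

-- Say the part meeting S in two vertices is V₁, with a ≠ b ∈ S ∩ V₁; then S ∩ V₂ has
-- n - 1 vertices. Two vertices of S ∩ V₂ adjacent to both a and b would close a
-- 4-cycle in B[S], so N(a), N(b) and S ∩ V₂ share at most one vertex. Applying
-- inclusion–exclusion twice inside V₂ gives |N(a)| + |N(b)| + (n - 1) ≤ 2n + 1,
-- i.e. |N(a)| + |N(b)| ≤ n + 2. Together with 2|N(a)|, 2|N(b)| ≥ n + 2 this forces
-- 2|N(a)| = n + 2. The case where V₂ is the small part follows by transposing B.
module Submission where

open import Defs
open import Data.Nat using (ℕ; suc; _⊓_; _+_; _*_; _≤_; _≤?_)
open import Data.Nat.Properties
  using (+-suc; +-assoc; +-comm; +-identityʳ; *-comm; *-distribˡ-+; +-monoˡ-≤; +-monoʳ-≤; +-mono-≤;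
         *-monoʳ-≤; +-cancelʳ-≤; ≤-antisym; ≤-pred; ≤-reflexive; ≰⇒>; ⊓-sel; module ≤-Reasoning)
open import Data.Nat.Divisibility using (_∣_; divides; ∣m+n∣m⇒∣n)
open import Data.Bool using (true)
open import Data.Fin using (Fin; zero; suc; inject₁)
open import Data.Fin.Properties using (suc-injective)
open import Data.Fin.Subset using (Subset; Nonempty; _∈_; _∩_; _∪_; ∣_∣; inside; outside)
open import Data.Fin.Subset.Properties using (x∈p∩q⁻; ∣p∣≤n)
open import Data.Vec using ([]; _∷_; tabulate; here; there)
open import Data.Vec.Properties using ([]=⇒lookup; lookup∘tabulate)
open import Data.Product using (∃₂; _×_; _,_)
open import Data.Sum using (inj₁; inj₂; swap)
open import Data.Sum.Properties using (inj₁-injective; inj₂-injective; swap-involutive)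
open import Data.Empty using (⊥; ⊥-elim)
open import Function using (_∘_)
open import Function.Definitions using (Injective)
open import Relation.Binary.PropositionalEquality
open import Relation.Nullary using (¬_)
open import Relation.Nullary.Decidable using (decidable-stable)

∣p∣+∣q∣≡∣p∪q∣+∣p∩q∣ : ∀ {n} (p q : Subset n) → ∣ p ∣ + ∣ q ∣ ≡ ∣ p ∪ q ∣ + ∣ p ∩ q ∣
∣p∣+∣q∣≡∣p∪q∣+∣p∩q∣ []            []            = refl
∣p∣+∣q∣≡∣p∪q∣+∣p∩q∣ (inside  ∷ p) (inside  ∷ q) = cong suc (begin
  ∣ p ∣ + suc ∣ q ∣           ≡⟨ +-suc ∣ p ∣ ∣ q ∣ ⟩
  suc (∣ p ∣ + ∣ q ∣)         ≡⟨ cong suc (∣p∣+∣q∣≡∣p∪q∣+∣p∩q∣ p q) ⟩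
  suc (∣ p ∪ q ∣ + ∣ p ∩ q ∣) ≡⟨ +-suc ∣ p ∪ q ∣ ∣ p ∩ q ∣ ⟨
  ∣ p ∪ q ∣ + suc ∣ p ∩ q ∣   ∎)
  where open ≡-Reasoning
∣p∣+∣q∣≡∣p∪q∣+∣p∩q∣ (inside  ∷ p) (outside ∷ q) = cong suc (∣p∣+∣q∣≡∣p∪q∣+∣p∩q∣ p q)
∣p∣+∣q∣≡∣p∪q∣+∣p∩q∣ (outside ∷ p) (inside  ∷ q) =
  trans (+-suc ∣ p ∣ ∣ q ∣) (cong suc (∣p∣+∣q∣≡∣p∪q∣+∣p∩q∣ p q))
∣p∣+∣q∣≡∣p∪q∣+∣p∩q∣ (outside ∷ p) (outside ∷ q) = ∣p∣+∣q∣≡∣p∪q∣+∣p∩q∣ p q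

∣p∣+∣q∣+∣r∣≤n+n+∣p∩q∩r∣ : ∀ {n} (p q r : Subset n) →
                          ∣ p ∣ + ∣ q ∣ + ∣ r ∣ ≤ n + n + ∣ (p ∩ q) ∩ r ∣
∣p∣+∣q∣+∣r∣≤n+n+∣p∩q∩r∣ {n} p q r = begin
  ∣ p ∣ + ∣ q ∣ + ∣ r ∣                         ≡⟨ cong (_+ ∣ r ∣) (∣p∣+∣q∣≡∣p∪q∣+∣p∩q∣ p q) ⟩
  ∣ p ∪ q ∣ + ∣ p ∩ q ∣ + ∣ r ∣                 ≡⟨ +-assoc ∣ p ∪ q ∣ _ _ ⟩
  ∣ p ∪ q ∣ + (∣ p ∩ q ∣ + ∣ r ∣)               ≡⟨ cong (∣ p ∪ q ∣ +_) (∣p∣+∣q∣≡∣p∪q∣+∣p∩q∣ (p ∩ q) r) ⟩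
  ∣ p ∪ q ∣ + (∣ p ∩ q ∪ r ∣ + ∣ (p ∩ q) ∩ r ∣) ≡⟨ +-assoc ∣ p ∪ q ∣ _ _ ⟨
  ∣ p ∪ q ∣ + ∣ p ∩ q ∪ r ∣ + ∣ (p ∩ q) ∩ r ∣   ≤⟨ +-monoˡ-≤ _ (+-mono-≤ (∣p∣≤n (p ∪ q)) (∣p∣≤n (p ∩ q ∪ r))) ⟩
  n + n + ∣ (p ∩ q) ∩ r ∣                       ∎
  where open ≤-Reasoning

1≤∣p∣⇒Nonempty : ∀ {n} (p : Subset n) → 1 ≤ ∣ p ∣ → Nonempty p
1≤∣p∣⇒Nonempty (inside  ∷ p) _ = zero , here
1≤∣p∣⇒Nonempty (outside ∷ p) 1≤∣p∣ with 1≤∣p∣⇒Nonempty p 1≤∣p∣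
... | x , x∈p = suc x , there x∈p

2≤∣p∣⇒∃₂≢ : ∀ {n} (p : Subset n) → 2 ≤ ∣ p ∣ → ∃₂ λ x y → x ≢ y × x ∈ p × y ∈ p
2≤∣p∣⇒∃₂≢ (inside  ∷ p) 2≤∣p∣ with 1≤∣p∣⇒Nonempty p (≤-pred 2≤∣p∣)
... | y , y∈p = zero , suc y , (λ ()) , here , there y∈p
2≤∣p∣⇒∃₂≢ (outside ∷ p) 2≤∣p∣ with 2≤∣p∣⇒∃₂≢ p 2≤∣p∣
... | x , y , x≢y , x∈p , y∈p = suc x , suc y , x≢y ∘ suc-injective , there x∈p , there y∈p

m≤2x⇒m≤2y⇒x+y≤m⇒2x≡m : ∀ {m x y} → m ≤ 2 * x → m ≤ 2 * y → x + y ≤ m → 2 * x ≡ m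
m≤2x⇒m≤2y⇒x+y≤m⇒2x≡m {m} {x} {y} m≤2x m≤2y x+y≤m = ≤-antisym 2x≤m m≤2x
  where
  2x≤m : 2 * x ≤ m
  2x≤m = +-cancelʳ-≤ m (2 * x) m (begin
    2 * x + m     ≤⟨ +-monoʳ-≤ (2 * x) m≤2y ⟩
    2 * x + 2 * y ≡⟨ *-distribˡ-+ 2 x y ⟨
    2 * (x + y)   ≤⟨ *-monoʳ-≤ 2 x+y≤m ⟩
    2 * m         ≡⟨ cong (m +_) (+-identityʳ m) ⟩
    m + m         ∎)
    where open ≤-Reasoning

2*x≡n+2⇒2∣n : ∀ {n x} → 2 * x ≡ n + 2 → 2 ∣ n
2*x≡n+2⇒2∣n {n} {x} 2x≡n+2 =
  ∣m+n∣m⇒∣n (divides x (trans (+-comm 2 n) (trans (sym 2x≡n+2) (*-comm 2 x)))) (divides 1 refl)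

module _ {n} (B : BBGraph n) where

  Adj-irrefl : ∀ u → ¬ Adj B u u
  Adj-irrefl (inj₁ _) ()
  Adj-irrefl (inj₂ _) ()

  Adj⇒≢ : ∀ {u v} → Adj B u v → u ≢ v
  Adj⇒≢ {u} uv refl = Adj-irrefl u uv

  square⇒cycle : ∀ {S u v w z} → u ≢ w → v ≢ z →
                 Adj B u v → Adj B v w → Adj B w z → Adj B z u →
                 u ∈S S → v ∈S S → w ∈S S → z ∈S S → CycleIn B S
  square⇒cycle {S} {u} {v} {w} {z} u≢w v≢z uv vw wz zu u∈S v∈S w∈S z∈S =
    record { m = 1 ; vs = vs ; inj = inj ; inS = inS ; step = step ; close = zu }
    where
    vs : Fin 4 → Vertex n
    vs zero                   = u
    vs (suc zero)             = v
    vs (suc (suc zero))       = w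
    vs (suc (suc (suc zero))) = z

    inj : Injective _≡_ _≡_ vs
    inj {zero}                   {zero}                   _ = refl
    inj {zero}                   {suc zero}               e = ⊥-elim (Adj⇒≢ uv e)
    inj {zero}                   {suc (suc zero)}         e = ⊥-elim (u≢w e)
    inj {zero}                   {suc (suc (suc zero))}   e = ⊥-elim (Adj⇒≢ zu (sym e))
    inj {suc zero}               {zero}                   e = ⊥-elim (Adj⇒≢ uv (sym e))
    inj {suc zero}               {suc zero}               _ = refl
    inj {suc zero}               {suc (suc zero)}         e = ⊥-elim (Adj⇒≢ vw e)
    inj {suc zero}               {suc (suc (suc zero))}   e = ⊥-elim (v≢z e)
    inj {suc (suc zero)}         {zero}                   e = ⊥-elim (u≢w (sym e))
    inj {suc (suc zero)}         {suc zero}               e = ⊥-elim (Adj⇒≢ vw (sym e))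
    inj {suc (suc zero)}         {suc (suc zero)}         _ = refl
    inj {suc (suc zero)}         {suc (suc (suc zero))}   e = ⊥-elim (Adj⇒≢ wz e)
    inj {suc (suc (suc zero))}   {zero}                   e = ⊥-elim (Adj⇒≢ zu e)
    inj {suc (suc (suc zero))}   {suc zero}               e = ⊥-elim (v≢z (sym e))
    inj {suc (suc (suc zero))}   {suc (suc zero)}         e = ⊥-elim (Adj⇒≢ wz (sym e))
    inj {suc (suc (suc zero))}   {suc (suc (suc zero))}   _ = refl

    inS : ∀ i → vs i ∈S S
    inS zero                   = u∈S
    inS (suc zero)             = v∈S
    inS (suc (suc zero))       = w∈S
    inS (suc (suc (suc zero))) = z∈S

    step : ∀ (i : Fin 3) → Adj B (vs (inject₁ i)) (vs (suc i))
    step zero             = uv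
    step (suc zero)       = vw
    step (suc (suc zero)) = wz

  neighbours : Fin n → Subset n
  neighbours i = tabulate (edge B i)

  ∈-neighbours⇒edge : ∀ {i j} → j ∈ neighbours i → edge B i j ≡ true
  ∈-neighbours⇒edge {i} {j} j∈Nᵢ = trans (sym (lookup∘tabulate (edge B i) j)) ([]=⇒lookup j∈Nᵢ)

  forest⇒∣common-neighbours∣≤1 : ∀ {S a b} → IsForest B S → a ≢ b → a ∈ part₁ S → b ∈ part₁ S →
                                 ∣ (neighbours a ∩ neighbours b) ∩ part₂ S ∣ ≤ 1
  forest⇒∣common-neighbours∣≤1 {S} {a} {b} forest a≢b a∈S b∈S =
    decidable-stable (∣ common ∣ ≤? 1) (λ ∣common∣≰1 → two-common⇒cycle (2≤∣p∣⇒∃₂≢ common (≰⇒> ∣common∣≰1)))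
    where
    common : Subset n
    common = (neighbours a ∩ neighbours b) ∩ part₂ S

    common⁻ : ∀ {x} → x ∈ common → edge B a x ≡ true × edge B b x ≡ true × x ∈ part₂ S
    common⁻ x∈common with x∈p∩q⁻ (neighbours a ∩ neighbours b) (part₂ S) x∈common
    ... | x∈Nₐ∩N_b , x∈S with x∈p∩q⁻ (neighbours a) (neighbours b) x∈Nₐ∩N_b
    ... | x∈Nₐ , x∈N_b = ∈-neighbours⇒edge x∈Nₐ , ∈-neighbours⇒edge x∈N_b , x∈S

    two-common⇒cycle : (∃₂ λ x y → x ≢ y × x ∈ common × y ∈ common) → ⊥
    two-common⇒cycle (x , y , x≢y , x∈common , y∈common)
      with common⁻ x∈common | common⁻ y∈common
    ... | ax , bx , x∈S | ay , by , y∈S =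
      forest (square⇒cycle (a≢b ∘ inj₁-injective) (x≢y ∘ inj₂-injective) ax bx by ay a∈S x∈S b∈S y∈S)

transpose : ∀ {n} → BBGraph n → BBGraph n
transpose B = record { edge = λ i j → edge B j i }

swapSides : ∀ {n} → VSubset n → VSubset n
swapSides S = ⟨ part₂ S , part₁ S ⟩

module _ {n} (B : BBGraph n) where

  Adj-transpose : ∀ u v → Adj (transpose B) u v → Adj B (swap u) (swap v)
  Adj-transpose (inj₁ _) (inj₂ _) uv = uv
  Adj-transpose (inj₂ _) (inj₁ _) uv = uv

  MinDegree-transpose : MinDegreeAtLeastHalfPlusOne B → MinDegreeAtLeastHalfPlusOne (transpose B)
  MinDegree-transpose δ≥ (inj₁ j) = δ≥ (inj₂ j)
  MinDegree-transpose δ≥ (inj₂ i) = δ≥ (inj₁ i)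

  IsForest-transpose : ∀ {S} → IsForest B S → IsForest (transpose B) (swapSides S)
  IsForest-transpose {S} forest C = forest record
    { m     = m
    ; vs    = swap ∘ vs
    ; inj   = λ e → inj (swap-injective e)
    ; inS   = λ i → ∈S-swapSides (vs i) (inS i)
    ; step  = λ i → Adj-transpose _ _ (step i)
    ; close = Adj-transpose _ _ close
    }
    where
    open CycleIn C

    swap-injective : ∀ {u v : Vertex n} → swap u ≡ swap v → u ≡ v
    swap-injective {u} {v} e = trans (sym (swap-involutive u)) (trans (cong swap e) (swap-involutive v))

    ∈S-swapSides : ∀ u → u ∈S swapSides S → swap u ∈S S
    ∈S-swapSides (inj₁ _) u∈S = u∈S
    ∈S-swapSides (inj₂ _) u∈S = u∈S

∣part₁∣≡2⇒2∣n : ∀ {n} (B : BBGraph n) → MinDegreeAtLeastHalfPlusOne B → (S : VSubset n) →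
                size S ≡ n + 1 → IsForest B S → ∣ part₁ S ∣ ≡ 2 → 2 ∣ n
∣part₁∣≡2⇒2∣n {n} B δ≥ S |S|≡n+1 forest ∣S₁∣≡2 with 2≤∣p∣⇒∃₂≢ (part₁ S) (≤-reflexive (sym ∣S₁∣≡2))
... | a , b , a≢b , a∈S , b∈S =
  2*x≡n+2⇒2∣n {x = ∣ Nₐ ∣} 2∣Nₐ∣≡n+2
  where
  Nₐ N_b S₂ : Subset n
  Nₐ  = neighbours B a
  N_b = neighbours B b
  S₂  = part₂ S

  2+∣S₂∣≡n+1 : 2 + ∣ S₂ ∣ ≡ n + 1
  2+∣S₂∣≡n+1 = trans (cong (_+ ∣ S₂ ∣) (sym ∣S₁∣≡2)) |S|≡n+1

  ∣Nₐ∣+∣N_b∣≤n+2 : ∣ Nₐ ∣ + ∣ N_b ∣ ≤ n + 2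
  ∣Nₐ∣+∣N_b∣≤n+2 = +-cancelʳ-≤ ∣ S₂ ∣ _ _ (begin
    ∣ Nₐ ∣ + ∣ N_b ∣ + ∣ S₂ ∣   ≤⟨ ∣p∣+∣q∣+∣r∣≤n+n+∣p∩q∩r∣ Nₐ N_b S₂ ⟩
    n + n + ∣ (Nₐ ∩ N_b) ∩ S₂ ∣ ≤⟨ +-monoʳ-≤ (n + n) (forest⇒∣common-neighbours∣≤1 B forest a≢b a∈S b∈S) ⟩
    n + n + 1                 ≡⟨ +-assoc n n 1 ⟩
    n + (n + 1)               ≡⟨ cong (n +_) 2+∣S₂∣≡n+1 ⟨
    n + (2 + ∣ S₂ ∣)          ≡⟨ +-assoc n 2 ∣ S₂ ∣ ⟨
    n + 2 + ∣ S₂ ∣            ∎)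
    where open ≤-Reasoning

  2∣Nₐ∣≡n+2 : 2 * ∣ Nₐ ∣ ≡ n + 2
  2∣Nₐ∣≡n+2 = m≤2x⇒m≤2y⇒x+y≤m⇒2x≡m {x = ∣ Nₐ ∣} {y = ∣ N_b ∣} (δ≥ (inj₁ a)) (δ≥ (inj₁ b)) ∣Nₐ∣+∣N_b∣≤n+2

theorem3 : (n : ℕ) → 1 ≤ n → (B : BBGraph n) → MinDegreeAtLeastHalfPlusOne B →
           (S : VSubset n) → size S ≡ n + 1 → IsForest B S →
           ∣ part₁ S ∣ ⊓ ∣ part₂ S ∣ ≡ 2 → 2 ∣ n
theorem3 n _ B δ≥ S |S|≡n+1 forest min≡2 with ⊓-sel ∣ part₁ S ∣ ∣ part₂ S ∣
... | inj₁ min≡∣S₁∣ = ∣part₁∣≡2⇒2∣n B δ≥ S |S|≡n+1 forest (trans (sym min≡∣S₁∣) min≡2)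
... | inj₂ min≡∣S₂∣ =
  ∣part₁∣≡2⇒2∣n (transpose B) (MinDegree-transpose B δ≥) (swapSides S)
    (trans (+-comm ∣ part₂ S ∣ ∣ part₁ S ∣) |S|≡n+1) (IsForest-transpose B forest) (trans (sym min≡∣S₂∣) min≡2)
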